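{- Let $m,n,k\geq 1$ be integers, and for integers $i,j$ set $\alpha_{i,j}=\chi(j\text{ is odd})+\chi(j\text{ is even and } i=n)$ and $\beta_{i,j}=\chi(j\text{ is even})+\chi(j\text{ is odd and } i=n)$, where $\chi(P)$ is $1$ if statement $P$ is true and $0$ otherwise. Then $$\binom{m+n-k-1}{k-1}=\sum_{i=0}^n\sum_{j=0}^m \alpha_{i,j}(-1)^{(i+1)j}\binom{n}{i}\binom{m-\lfloor j/2\rfloor-1}{m-j}\binom{i-k+\lceil j/2\rceil-1}{i-2k+j},$$ $$\binom{m+n-k}{k-1}=\sum_{i=0}^n\sum_{j=0}^m \alpha_{i,j}(-1)^{ij}\binom{n}{i}\binom{m-\lfloor j/2\rfloor-1}{m-j}\binom{i-k+\lfloor j/2\rfloor}{i-2k+j+1},$$ $$\binom{m+n-k}{k}=\sum_{i=0}^n\sum_{j=0}^m \beta_{i,j}(-1)^{i(j+1)}\binom{n}{i}\binom{m-\lceil j/2\rceil}{m-j}\binom{i-k+\lceil j/2\rceil-1}{i-2k+j},$$ and $$\binom{m+n-k}{k-1}=\sum_{i=0}^n\sum_{j=0}^m \beta_{i,j}(-1)^{(i+1)(j+1)}\binom{n}{i}\binom{m-\lceil j/2\rceil}{m-j}\binom{i-k+\lfloor j/2\rfloor}{i-2k+j+1}.$$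
   Context: Binomial coefficient convention: for integers $a,b$, $\binom{a}{b}=\frac{a!}{b!(a-b)!}$ if $0\le b\le a$; $\binom{a}{0}=1$ for every integer $a$ (including negative $a$); and $\binom{a}{b}=0$ in all other cases. -}

module Defs where

open import Data.Nat as ℕ using (ℕ; zero; suc)
open import Data.Nat.Combinatorics using (_C_)
open import Data.Bool using (Bool; true; false; if_then_else_)
open import Data.Integer as ℤ using (ℤ; +_; -[1+_])

-- Binomial coefficient convention of the paper, on integers:
-- binom a b = a!/(b!(a-b)!) if 0 ≤ b ≤ a; binom a 0 = 1 for all a; 0 otherwise.
binom : ℤ → ℤ → ℤ
binom a (+ zero) = + 1
binom (+ a) (+ suc b) = + (a C suc b)   -- a C b = 0 when b > a
binom -[1+ a ] (+ suc b) = + 0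
binom a -[1+ b ] = + 0

Σ≤ : ℕ → (ℕ → ℤ) → ℤ
Σ≤ zero f = f zero
Σ≤ (suc n) f = Σ≤ n f ℤ.+ f (suc n)

isOdd : ℕ → Bool
isOdd zero = false
isOdd (suc n) = if isOdd n then false else true

χ : Bool → ℤ
χ true = + 1
χ false = + 0

sgn : ℕ → ℤ
sgn e = if isOdd e then ℤ.- (+ 1) else + 1

⌊_/2⌋ : ℕ → ℕ
⌊ zero /2⌋ = zero
⌊ suc zero /2⌋ = zero
⌊ suc (suc j) /2⌋ = suc ⌊ j /2⌋

⌈_/2⌉ : ℕ → ℕ
⌈ j /2⌉ = ⌊ suc j /2⌋

_≡ᵇ_ : ℕ → ℕ → Bool
zero ≡ᵇ zero = true
zero ≡ᵇ suc _ = false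
suc _ ≡ᵇ zero = false
suc a ≡ᵇ suc b = a ≡ᵇ b

α : ℕ → ℕ → ℕ → ℤ
α n i j = χ (isOdd j) ℤ.+ χ (if isOdd j then false else (i ≡ᵇ n))

β : ℕ → ℕ → ℕ → ℤ
β n i j = χ (if isOdd j then false else true) ℤ.+ χ (if isOdd j then (i ≡ᵇ n) else false)

-- Exchanging the two sums writes each right-hand side as S_m(k) = Σ_j F_m(j) I_k(j), where F_m(j)
-- is the binomial coefficient in m and I_k(j) the inner sum over i. The weights α, β and the signs are
-- 2-periodic in j, so I_k(j + 2) = I_{k-1}(j); Pascal's rule gives F_{m+2}(j + 2) = F_{m+1}(j + 2) + F_m(j).
-- Hence S_{m+2}(k) = S_{m+1}(k) + S_m(k - 1), a recurrence that the left-hand side satisfies by Pascal's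
-- rule as well, and the identities reduce to m = 1 and m = 2, that is, to I_k(0) and I_k(1). One of the
-- two is a single term (the indicator in α or β only keeps i = n); the other is an alternating sum
-- Σ_i (-1)^i C(n, i) C(i - k, i - 2k + e) with e ∈ {1, 2}, evaluated by induction on n through
-- Σ_i (-1)^i C(n + 1, i) G(i) = Σ_i (-1)^i C(n, i) (G(i) - G(i + 1)). Since the recurrence lowers k,
-- k ranges over all integers throughout.

module Submission where

open import Defs
open import Data.Nat as ℕ using (ℕ; suc; zero)
open import Data.Integer as ℤ using (ℤ; +_; -[1+_]; _+_; _-_; _*_; -_)
open import Data.Bool using (true; false; if_then_else_)
open import Data.Product using (_×_; _,_; Σ; proj₁; proj₂)
open import Data.Sum using (_⊎_; inj₁; inj₂)
open import Relation.Binary.PropositionalEquality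
open import Relation.Nullary using (yes; no; contradiction)
open import Data.Nat.Combinatorics
  using (_C_; k>n⇒nCk≡0; nCk≡nC[n∸k]; nCn≡1; nCk+nC[k+1]≡[n+1]C[k+1])
import Data.Nat.Properties as ℕP
import Data.Integer.Properties as ℤP
open import Data.Integer.Tactic.RingSolver using (solve-∀)
open import Algebra.Properties.CommutativeSemigroup ℤP.+-commutativeSemigroup
  using (interchange)

Σ≤-cong : ∀ n {f g : ℕ → ℤ} → (∀ i → f i ≡ g i) → Σ≤ n f ≡ Σ≤ n g
Σ≤-cong zero    f≗g = f≗g zero
Σ≤-cong (suc n) f≗g = cong₂ _+_ (Σ≤-cong n f≗g) (f≗g (suc n))

Σ≤-+ : ∀ n (f g : ℕ → ℤ) → Σ≤ n (λ i → f i + g i) ≡ Σ≤ n f + Σ≤ n g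
Σ≤-+ zero    f g = refl
Σ≤-+ (suc n) f g = trans (cong (_+ (f (suc n) + g (suc n))) (Σ≤-+ n f g))
                         (interchange (Σ≤ n f) (Σ≤ n g) (f (suc n)) (g (suc n)))

Σ≤-*ˡ : ∀ n c (f : ℕ → ℤ) → Σ≤ n (λ i → c * f i) ≡ c * Σ≤ n f
Σ≤-*ˡ zero    c f = refl
Σ≤-*ˡ (suc n) c f =
  trans (cong (_+ c * f (suc n)) (Σ≤-*ˡ n c f)) (sym (ℤP.*-distribˡ-+ c (Σ≤ n f) (f (suc n))))

Σ≤-neg : ∀ n (f : ℕ → ℤ) → Σ≤ n (λ i → - f i) ≡ - Σ≤ n f
Σ≤-neg zero    f = refl
Σ≤-neg (suc n) f =
  trans (cong (_+ - f (suc n)) (Σ≤-neg n f)) (sym (ℤP.neg-distrib-+ (Σ≤ n f) (f (suc n))))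

Σ≤-comm : ∀ n m (h : ℕ → ℕ → ℤ) →
          Σ≤ n (λ i → Σ≤ m (h i)) ≡ Σ≤ m (λ j → Σ≤ n (λ i → h i j))
Σ≤-comm zero    m h = refl
Σ≤-comm (suc n) m h =
  trans (cong (_+ Σ≤ m (h (suc n))) (Σ≤-comm n m h)) (sym (Σ≤-+ m _ (h (suc n))))

Σ≤-exchange : ∀ n m (a : ℕ → ℕ → ℤ) (c : ℕ → ℤ) (b : ℕ → ℕ → ℤ) →
  Σ≤ n (λ i → Σ≤ m (λ j → a i j * c j * b i j)) ≡ Σ≤ m (λ j → c j * Σ≤ n (λ i → a i j * b i j))
Σ≤-exchange n m a c b = trans (Σ≤-comm n m _) (Σ≤-cong m λ j →
  trans (Σ≤-cong n λ i → reorder (a i j) (c j) (b i j)) (Σ≤-*ˡ n (c j) _))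
  where
  reorder : ∀ (x y z : ℤ) → x * y * z ≡ y * (x * z)
  reorder = solve-∀

Σ≤-suc : ∀ n (f : ℕ → ℤ) → Σ≤ (suc n) f ≡ f 0 + Σ≤ n (λ i → f (suc i))
Σ≤-suc zero    f = refl
Σ≤-suc (suc n) f = trans (cong (_+ f (suc (suc n))) (Σ≤-suc n f))
                         (ℤP.+-assoc (f 0) (Σ≤ n (λ i → f (suc i))) (f (suc (suc n))))

Σ≤-suc² : ∀ n (f : ℕ → ℤ) → Σ≤ (suc (suc n)) f ≡ f 0 + (f 1 + Σ≤ n (λ i → f (suc (suc i))))
Σ≤-suc² n f = trans (Σ≤-suc (suc n) f) (cong (_+_ (f 0)) (Σ≤-suc n (λ i → f (suc i))))

Σ≤-last : ∀ n (f : ℕ → ℤ) → (∀ i → i ℕ.< n → f i ≡ + 0) → Σ≤ n f ≡ f n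
Σ≤-last zero    f below = refl
Σ≤-last (suc n) f below = trans (cong (_+ f (suc n)) Σ≤n≡0) (ℤP.+-identityˡ _)
  where
  Σ≤n≡0 : Σ≤ n f ≡ + 0
  Σ≤n≡0 = trans (Σ≤-last n f (λ i i<n → below i (ℕP.m<n⇒m<1+n i<n))) (below n (ℕP.n<1+n n))

-- Binomial coefficients with integer arguments

binom-+ : ∀ x y → binom (+ x) (+ y) ≡ + (x C y)
binom-+ x zero    = refl
binom-+ x (suc y) = refl

binom-+-> : ∀ {x y} → x ℕ.< y → binom (+ x) (+ y) ≡ + 0
binom-+-> {x} {y} x<y = trans (binom-+ x y) (cong +_ (k>n⇒nCk≡0 x<y))

binom-+-diag : ∀ x → binom (+ x) (+ x) ≡ + 1
binom-+-diag x = trans (binom-+ x x) (cong +_ (nCn≡1 x))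

binom-+-pascal : ∀ x y → binom (+ suc x) (+ suc y) ≡ binom (+ x) (+ y) + binom (+ x) (+ suc y)
binom-+-pascal x y =
  trans (cong +_ (sym (nCk+nC[k+1]≡[n+1]C[k+1] x y))) (cong (_+ + (x C suc y)) (sym (binom-+ x y)))

+x+1≡+[1+x] : ∀ x → + x + + 1 ≡ + suc x
+x+1≡+[1+x] x = cong +_ (ℕP.+-comm x 1)

binom-sub-> : ∀ a {x y} → x ℕ.< y → binom a (+ x - + y) ≡ + 0
binom-sub-> a {x} {suc y} (ℕ.s≤s x≤y) =
  cong (binom a) (trans (ℤP.m-n≡m⊖n x (suc y))
                 (trans (ℤP.⊖-< (ℕ.s≤s x≤y)) (cong (λ d → - + d) (ℕP.+-∸-assoc 1 x≤y))))

-- Pascal's rule fails only for a < 0, b = 0, because binom a 0 = 1 for every a.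
binom-pascal : ∀ a b → (b ≡ + 0 → + 0 ℤ.≤ a) →
               binom (a + + 1) (b + + 1) ≡ binom a b + binom a (b + + 1)
binom-pascal a           -[1+ zero ]  _ = refl
binom-pascal a           -[1+ suc y ] _ = refl
binom-pascal (+ x)       (+ y)        _ =
  trans (cong₂ binom (+x+1≡+[1+x] x) (+x+1≡+[1+x] y))
        (trans (binom-+-pascal x y) (cong (λ v → binom (+ x) (+ y) + binom (+ x) v) (sym (+x+1≡+[1+x] y))))
binom-pascal -[1+ x ]    (+ zero)     b≡0⇒0≤a with b≡0⇒0≤a refl
... | ()
binom-pascal -[1+ zero ]  (+ suc y)   _ = refl
binom-pascal -[1+ suc x ] (+ suc y)   _ = refl

binom-sym : ∀ x b → binom (+ x) b ≡ binom (+ x) (+ x - b)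
binom-sym x -[1+ y ] = sym (binom-+-> (ℕP.m<m+n x (ℕ.s≤s ℕ.z≤n)))
binom-sym x (+ y) with y ℕP.≤? x
... | yes y≤x = begin
  binom (+ x) (+ y)         ≡⟨ binom-+ x y ⟩
  + (x C y)                 ≡⟨ cong +_ (nCk≡nC[n∸k] y≤x) ⟩
  + (x C (x ℕ.∸ y))         ≡⟨ sym (binom-+ x (x ℕ.∸ y)) ⟩
  binom (+ x) (+ (x ℕ.∸ y)) ≡⟨ cong (binom (+ x)) (sym (trans (ℤP.m-n≡m⊖n x y) (ℤP.⊖-≥ y≤x))) ⟩
  binom (+ x) (+ x - + y)   ∎
  where open ≡-Reasoning
... | no y≰x = trans (binom-+-> (ℕP.≰⇒> y≰x)) (sym (binom-sub-> (+ x) (ℕP.≰⇒> y≰x)))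

binom-pascal-sym : ∀ a b → + 0 ℤ.≤ a ⊎ + 0 ℤ.< b →
                   binom a b + binom a (a - b + + 1) ≡ binom (a + + 1) b
binom-pascal-sym (+ x) b _ = begin
  binom (+ x) b + binom (+ x) (+ x - b + + 1)
    ≡⟨ cong (λ v → binom (+ x) b + v)
            (trans (cong (binom (+ x)) (reflect (+ x) b)) (sym (binom-sym x (b - + 1)))) ⟩
  binom (+ x) b + binom (+ x) (b - + 1)
    ≡⟨ ℤP.+-comm (binom (+ x) b) (binom (+ x) (b - + 1)) ⟩
  binom (+ x) (b - + 1) + binom (+ x) b
    ≡⟨ cong (λ v → binom (+ x) (b - + 1) + binom (+ x) v) (pred-suc b) ⟩
  binom (+ x) (b - + 1) + binom (+ x) (b - + 1 + + 1)
    ≡⟨ sym (binom-pascal (+ x) (b - + 1) (λ _ → ℤ.+≤+ ℕ.z≤n)) ⟩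
  binom (+ x + + 1) (b - + 1 + + 1)
    ≡⟨ cong (binom (+ x + + 1)) (sym (pred-suc b)) ⟩
  binom (+ x + + 1) b ∎
  where
  open ≡-Reasoning
  reflect : ∀ (a b : ℤ) → a - b + + 1 ≡ a - (b - + 1)
  reflect = solve-∀
  pred-suc : ∀ (b : ℤ) → b ≡ b - + 1 + + 1
  pred-suc = solve-∀
binom-pascal-sym -[1+ zero ]  (+ suc y) _ = refl
binom-pascal-sym -[1+ suc x ] (+ suc y) _ = refl
binom-pascal-sym -[1+ x ] (+ zero)  (inj₁ ())
binom-pascal-sym -[1+ x ] (+ zero)  (inj₂ (ℤ.+<+ ()))
binom-pascal-sym -[1+ x ] -[1+ y ]  (inj₁ ())
binom-pascal-sym -[1+ x ] -[1+ y ]  (inj₂ ())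

sub≢0 : ∀ {x y} → x ℕ.< y → + x - + y ≢ + 0
sub≢0 {x} {y} x<y x-y≡0 = ℕP.<⇒≢ x<y (ℤP.+-injective (ℤP.i-j≡0⇒i≡j (+ x) (+ y) x-y≡0))

nonneg-or-exceeds : ∀ x K → + 0 ℤ.≤ + x - K ⊎ Σ ℕ (λ k → K ≡ + k × x ℕ.< k)
nonneg-or-exceeds x -[1+ k ] = inj₁ (ℤ.+≤+ ℕ.z≤n)
nonneg-or-exceeds x (+ k) with k ℕP.≤? x
... | yes k≤x = inj₁ (ℤP.i≤j⇒0≤j-i (ℤ.+≤+ k≤x))
... | no k≰x  = inj₂ (k , refl , ℕP.≰⇒> k≰x)

nonneg-or-pred-pos : ∀ n K → + 0 ℤ.≤ + suc n - K ⊎ + 0 ℤ.< K - + 1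
nonneg-or-pred-pos n K with nonneg-or-exceeds (suc n) K
... | inj₁ 0≤1+n-K                  = inj₁ 0≤1+n-K
... | inj₂ (suc (suc k) , refl , _) = inj₂ (ℤ.+<+ (ℕ.s≤s ℕ.z≤n))
... | inj₂ (suc zero , refl , ℕ.s≤s ())

isOdd-2+ : ∀ j → isOdd (suc (suc j)) ≡ isOdd j
isOdd-2+ j with isOdd j
... | true  = refl
... | false = refl

isOdd-*2+ : ∀ a x → isOdd (a ℕ.* 2 ℕ.+ x) ≡ isOdd x
isOdd-*2+ zero    x = refl
isOdd-*2+ (suc a) x = trans (isOdd-2+ (a ℕ.* 2 ℕ.+ x)) (isOdd-*2+ a x)

sgn-suc : ∀ i → sgn (suc i) ≡ - sgn i
sgn-suc i with isOdd i
... | true  = refl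
... | false = refl

sgn-*-2+ : ∀ a b → sgn (a ℕ.* suc (suc b)) ≡ sgn (a ℕ.* b)
sgn-*-2+ a b = cong (λ o → if o then - + 1 else + 1)
  (trans (cong isOdd (ℕP.*-distribˡ-+ a 2 b)) (isOdd-*2+ a (a ℕ.* b)))

sgn-*0 : ∀ a → sgn (a ℕ.* 0) ≡ + 1
sgn-*0 a = cong sgn (ℕP.*-zeroʳ a)

sgn-*1 : ∀ a → sgn (a ℕ.* 1) ≡ sgn a
sgn-*1 a = cong sgn (ℕP.*-identityʳ a)

sgn-*2 : ∀ a → sgn (a ℕ.* 2) ≡ + 1
sgn-*2 a = trans (sgn-*-2+ a 0) (sgn-*0 a)

α-2+ : ∀ n i j → α n i (suc (suc j)) ≡ α n i j
α-2+ n i j = cong (λ o → χ o + χ (if o then false else (i ≡ᵇ n))) (isOdd-2+ j)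

β-2+ : ∀ n i j → β n i (suc (suc j)) ≡ β n i j
β-2+ n i j =
  cong (λ o → χ (if o then false else true) + χ (if o then (i ≡ᵇ n) else false)) (isOdd-2+ j)

α-0 : ∀ n i → α n i 0 ≡ χ (i ≡ᵇ n)
α-0 n i = ℤP.+-identityˡ (χ (i ≡ᵇ n))

β-1 : ∀ n i → β n i 1 ≡ χ (i ≡ᵇ n)
β-1 n i = ℤP.+-identityˡ (χ (i ≡ᵇ n))

≡ᵇ-refl : ∀ n → (n ≡ᵇ n) ≡ true
≡ᵇ-refl zero    = refl
≡ᵇ-refl (suc n) = ≡ᵇ-refl n

<⇒≡ᵇ-false : ∀ {i n} → i ℕ.< n → (i ≡ᵇ n) ≡ false
<⇒≡ᵇ-false {zero}  {suc n} _           = refl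
<⇒≡ᵇ-false {suc i} {suc n} (ℕ.s≤s i<n) = <⇒≡ᵇ-false i<n

Σ≤-χ≡ᵇ : ∀ n (h : ℕ → ℤ) → Σ≤ n (λ i → χ (i ≡ᵇ n) * h i) ≡ h n
Σ≤-χ≡ᵇ n h = begin
  Σ≤ n (λ i → χ (i ≡ᵇ n) * h i) ≡⟨ Σ≤-last n _ (λ i i<n → cong (λ o → χ o * h i) (<⇒≡ᵇ-false i<n)) ⟩
  χ (n ≡ᵇ n) * h n              ≡⟨ cong (λ o → χ o * h n) (≡ᵇ-refl n) ⟩
  + 1 * h n                     ≡⟨ ℤP.*-identityˡ (h n) ⟩
  h n                           ∎
  where open ≡-Reasoning

-- Alternating binomial sums

Σ≤-sgn-suc : ∀ n (f : ℕ → ℤ) → Σ≤ n (λ i → sgn (suc i) * f i) ≡ - Σ≤ n (λ i → sgn i * f i)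
Σ≤-sgn-suc n f =
  trans (Σ≤-cong n λ i → trans (cong (_* f i) (sgn-suc i)) (sym (ℤP.neg-distribˡ-* (sgn i) (f i))))
        (Σ≤-neg n (λ i → sgn i * f i))

alt : ℕ → (ℕ → ℤ) → ℤ
alt n G = Σ≤ n (λ i → sgn i * (binom (+ n) (+ i) * G i))

alt-cong : ∀ n {G H : ℕ → ℤ} → (∀ i → G i ≡ H i) → alt n G ≡ alt n H
alt-cong n G≗H = Σ≤-cong n (λ i → cong (λ g → sgn i * (binom (+ n) (+ i) * g)) (G≗H i))

alt-+ : ∀ n (G H : ℕ → ℤ) → alt n (λ i → G i + H i) ≡ alt n G + alt n H
alt-+ n G H = trans (Σ≤-cong n (λ i → distrib (sgn i) (binom (+ n) (+ i)) (G i) (H i))) (Σ≤-+ n _ _)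
  where
  distrib : ∀ (s b g h : ℤ) → s * (b * (g + h)) ≡ s * (b * g) + s * (b * h)
  distrib = solve-∀

alt-0 : ∀ (G : ℕ → ℤ) → alt 0 G ≡ G 0
alt-0 G = trans (ℤP.*-identityˡ (+ 1 * G 0)) (ℤP.*-identityˡ (G 0))

alt-suc : ∀ n G → alt (suc n) G ≡ alt n G - alt n (λ i → G (suc i))
alt-suc n G = begin
  alt (suc n) G
    ≡⟨ Σ≤-suc n _ ⟩
  G₀ + Σ≤ n (λ i → sgn (suc i) * (binom (+ suc n) (+ suc i) * G (suc i)))
    ≡⟨ cong (_+_ G₀) (Σ≤-sgn-suc n _) ⟩
  G₀ - Σ≤ n (λ i → sgn i * (binom (+ suc n) (+ suc i) * G (suc i)))
    ≡⟨ cong (λ s → G₀ - s) (trans (Σ≤-cong n split) (Σ≤-+ n _ _)) ⟩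
  G₀ - (alt n (λ i → G (suc i)) + T)
    ≡⟨ rearrange G₀ (alt n (λ i → G (suc i))) T ⟩
  (G₀ - T) - alt n (λ i → G (suc i))
    ≡⟨ cong (_- alt n (λ i → G (suc i))) (sym alt≡G₀-T) ⟩
  alt n G - alt n (λ i → G (suc i)) ∎
  where
  open ≡-Reasoning
  G₀ T : ℤ
  G₀ = sgn 0 * (binom (+ n) (+ 0) * G 0)
  T  = Σ≤ n (λ i → sgn i * (binom (+ n) (+ suc i) * G (suc i)))
  rearrange : ∀ (g a t : ℤ) → g - (a + t) ≡ (g - t) - a
  rearrange = solve-∀
  distrib : ∀ (s b c g : ℤ) → s * ((b + c) * g) ≡ s * (b * g) + s * (c * g)
  distrib = solve-∀
  split : ∀ i → sgn i * (binom (+ suc n) (+ suc i) * G (suc i))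
              ≡ sgn i * (binom (+ n) (+ i) * G (suc i)) + sgn i * (binom (+ n) (+ suc i) * G (suc i))
  split i = trans (cong (λ b → sgn i * (b * G (suc i))) (binom-+-pascal n i))
                  (distrib (sgn i) (binom (+ n) (+ i)) (binom (+ n) (+ suc i)) (G (suc i)))
  top-vanishes : sgn (suc n) * (binom (+ n) (+ suc n) * G (suc n)) ≡ + 0
  top-vanishes =
    trans (cong (λ b → sgn (suc n) * (b * G (suc n))) (binom-+-> (ℕP.n<1+n n)))
          (trans (cong (sgn (suc n) *_) (ℤP.*-zeroˡ (G (suc n)))) (ℤP.*-zeroʳ (sgn (suc n))))
  alt≡G₀-T : alt n G ≡ G₀ - T
  alt≡G₀-T = begin
    alt n G                ≡⟨ sym (trans (cong (_+_ (alt n G)) top-vanishes) (ℤP.+-identityʳ (alt n G))) ⟩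
    Σ≤ (suc n) (λ i → sgn i * (binom (+ n) (+ i) * G i))
                           ≡⟨ Σ≤-suc n _ ⟩
    G₀ + Σ≤ n (λ i → sgn (suc i) * (binom (+ n) (+ suc i) * G (suc i)))
                           ≡⟨ cong (_+_ G₀) (Σ≤-sgn-suc n _) ⟩
    G₀ - T                 ∎

skewBinom : ℕ → ℤ → ℕ → ℤ
skewBinom e K i = binom (+ i - K) (+ i - + 2 * K + + e)

skewBinom₁-suc : ∀ K i → skewBinom 1 K (suc i) ≡ skewBinom 1 K i + skewBinom 2 K i
skewBinom₁-suc K i = begin
  binom (+ suc i - K) (+ suc i - + 2 * K + + 1)
    ≡⟨ cong₂ binom (shift₁ (+ i) K) (shift₂ (+ i) K) ⟩
  binom (+ i - K + + 1) (+ i - + 2 * K + + 1 + + 1)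
    ≡⟨ binom-pascal (+ i - K) (+ i - + 2 * K + + 1) nonneg ⟩
  skewBinom 1 K i + binom (+ i - K) (+ i - + 2 * K + + 1 + + 1)
    ≡⟨ cong (λ b → skewBinom 1 K i + binom (+ i - K) b) (shift₃ (+ i) K) ⟩
  skewBinom 1 K i + skewBinom 2 K i ∎
  where
  open ≡-Reasoning
  shift₁ : ∀ (I K : ℤ) → + 1 + I - K ≡ I - K + + 1
  shift₁ = solve-∀
  shift₂ : ∀ (I K : ℤ) → + 1 + I - + 2 * K + + 1 ≡ I - + 2 * K + + 1 + + 1
  shift₂ = solve-∀
  shift₃ : ∀ (I K : ℤ) → I - + 2 * K + + 1 + + 1 ≡ I - + 2 * K + + 2
  shift₃ = solve-∀
  shift₄ : ∀ (I K : ℤ) → I - + 2 * K + + 1 ≡ + 1 + I - + 2 * K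
  shift₄ = solve-∀
  nonneg : + i - + 2 * K + + 1 ≡ + 0 → + 0 ℤ.≤ + i - K
  nonneg e with nonneg-or-exceeds i K
  ... | inj₁ 0≤i-K = 0≤i-K
  ... | inj₂ (k , refl , i<k) = contradiction
          (trans (cong (_-_ (+ suc i)) (ℤP.pos-* 2 k)) (trans (sym (shift₄ (+ i) (+ k))) e))
          (sub≢0 {y = 2 ℕ.* k} 1+i<2k)
    where
    1+i<2k : suc i ℕ.< 2 ℕ.* k
    1+i<2k = ℕP.<-≤-trans (ℕP.m<n+m (suc i) (ℕP.≤-<-trans ℕ.z≤n i<k))
                          (ℕP.+-monoʳ-≤ k (ℕP.m≤n⇒m≤n+o 0 i<k))

skewBinom₂-suc : ∀ K i → skewBinom 2 K (suc i) ≡ skewBinom 1 (K - + 1) i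
skewBinom₂-suc K i = cong₂ binom (shift₁ (+ i) K) (shift₂ (+ i) K)
  where
  shift₁ : ∀ (I K : ℤ) → + 1 + I - K ≡ I - (K - + 1)
  shift₁ = solve-∀
  shift₂ : ∀ (I K : ℤ) → + 1 + I - + 2 * K + + 2 ≡ I - + 2 * (K - + 1) + + 1
  shift₂ = solve-∀

alt-skewBinom₁-suc : ∀ n K → alt (suc n) (skewBinom 1 K) ≡ - alt n (skewBinom 2 K)
alt-skewBinom₁-suc n K = begin
  alt (suc n) (skewBinom 1 K)
    ≡⟨ alt-suc n (skewBinom 1 K) ⟩
  alt n (skewBinom 1 K) - alt n (λ i → skewBinom 1 K (suc i))
    ≡⟨ cong (_-_ (alt n (skewBinom 1 K))) (trans (alt-cong n (skewBinom₁-suc K)) (alt-+ n _ _)) ⟩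
  alt n (skewBinom 1 K) - (alt n (skewBinom 1 K) + alt n (skewBinom 2 K))
    ≡⟨ cancel (alt n (skewBinom 1 K)) (alt n (skewBinom 2 K)) ⟩
  - alt n (skewBinom 2 K) ∎
  where
  open ≡-Reasoning
  cancel : ∀ (a b : ℤ) → a - (a + b) ≡ - b
  cancel = solve-∀

alt-skewBinom₂-suc : ∀ n K →
  alt (suc n) (skewBinom 2 K) ≡ alt n (skewBinom 2 K) - alt n (skewBinom 1 (K - + 1))
alt-skewBinom₂-suc n K =
  trans (alt-suc n (skewBinom 2 K)) (cong (_-_ (alt n (skewBinom 2 K))) (alt-cong n (skewBinom₂-suc K)))

skewBinom₂-0 : ∀ K → skewBinom 2 K 0 ≡ binom (+ 1 - K) (K - + 1)
skewBinom₂-0 (+ 0)                   = refl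
skewBinom₂-0 (+ 1)                   = refl
skewBinom₂-0 (+ 2)                   = refl
skewBinom₂-0 (+ suc (suc (suc k)))   = refl
skewBinom₂-0 -[1+ k ] =
  trans (cong₂ binom (top (+ k)) (bottom (+ k))) (binom-+-> (ℕP.m<m+n (suc k) (ℕ.s≤s ℕ.z≤n)))
  where
  top : ∀ (x : ℤ) → + 0 - - (+ 1 + x) ≡ + 1 + x
  top = solve-∀
  bottom : ∀ (x : ℤ) → + 0 - + 2 * - (+ 1 + x) + + 2 ≡ (+ 1 + x) + (+ 3 + x)
  bottom = solve-∀

skewBinom₂-0-skewBinom₁-0 : ∀ K →
  skewBinom 2 K 0 - skewBinom 1 (K - + 1) 0 ≡ binom (+ 1 - K + + 1) (K - + 1)
skewBinom₂-0-skewBinom₁-0 (+ 0)                 = refl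
skewBinom₂-0-skewBinom₁-0 (+ 1)                 = refl
skewBinom₂-0-skewBinom₁-0 (+ 2)                 = refl
skewBinom₂-0-skewBinom₁-0 (+ suc (suc (suc k))) = refl
skewBinom₂-0-skewBinom₁-0 -[1+ k ] =
  cong₂ _-_ (skewBinom₂-0 -[1+ k ])
            (trans (cong₂ binom (top (+ k)) (bottom (+ k)))
                   (binom-+-> (ℕP.m<m+n (suc (suc k)) (ℕ.s≤s ℕ.z≤n))))
  where
  top : ∀ (x : ℤ) → + 0 - (- (+ 1 + x) - + 1) ≡ + 2 + x
  top = solve-∀
  bottom : ∀ (x : ℤ) → + 0 - + 2 * (- (+ 1 + x) - + 1) + + 1 ≡ (+ 2 + x) + (+ 3 + x)
  bottom = solve-∀

alt-skewBinom : ∀ n K → alt (suc n) (skewBinom 1 K) ≡ - binom (+ suc n - K) (K - + 1)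
                      × alt (suc n) (skewBinom 2 K) ≡ binom (+ suc n - K + + 1) (K - + 1)
alt-skewBinom zero K =
    trans (alt-skewBinom₁-suc 0 K) (cong -_ (trans (alt-0 (skewBinom 2 K)) (skewBinom₂-0 K)))
  , trans (alt-skewBinom₂-suc 0 K)
          (trans (cong₂ _-_ (alt-0 (skewBinom 2 K)) (alt-0 (skewBinom 1 (K - + 1))))
                 (skewBinom₂-0-skewBinom₁-0 K))
alt-skewBinom (suc n) K with alt-skewBinom n K | alt-skewBinom n (K - + 1)
... | _ , IH₂ | IH₁′ , _ =
    trans (alt-skewBinom₁-suc (suc n) K)
          (cong -_ (trans IH₂ (cong (λ a → binom a (K - + 1)) (top (+ n) K))))
  , (begin
    alt (suc (suc n)) (skewBinom 2 K)
      ≡⟨ alt-skewBinom₂-suc (suc n) K ⟩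
    alt (suc n) (skewBinom 2 K) - alt (suc n) (skewBinom 1 (K - + 1))
      ≡⟨ cong₂ _-_ IH₂ IH₁′ ⟩
    binom a (K - + 1) - - binom (+ suc n - (K - + 1)) (K - + 1 - + 1)
      ≡⟨ cong₂ (λ u v → binom a u - - binom v (K - + 1 - + 1)) (pred-suc K) (top′ (+ n) K) ⟩
    binom a (K - + 1 - + 1 + + 1) - - binom a (K - + 1 - + 1)
      ≡⟨ sub-neg (binom a (K - + 1 - + 1 + + 1)) (binom a (K - + 1 - + 1)) ⟩
    binom a (K - + 1 - + 1) + binom a (K - + 1 - + 1 + + 1)
      ≡⟨ sym (binom-pascal a (K - + 1 - + 1) nonneg) ⟩
    binom (a + + 1) (K - + 1 - + 1 + + 1)
      ≡⟨ cong₂ binom (cong (_+ + 1) (top (+ n) K)) (sym (pred-suc K)) ⟩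
    binom (+ suc (suc n) - K + + 1) (K - + 1) ∎)
  where
  open ≡-Reasoning
  a : ℤ
  a = + suc n - K + + 1
  top : ∀ (x K : ℤ) → + 1 + x - K + + 1 ≡ + 1 + (+ 1 + x) - K
  top = solve-∀
  top′ : ∀ (x K : ℤ) → + 1 + x - (K - + 1) ≡ + 1 + x - K + + 1
  top′ = solve-∀
  pred-suc : ∀ (K : ℤ) → K - + 1 ≡ K - + 1 - + 1 + + 1
  pred-suc = solve-∀
  sub-neg : ∀ (x y : ℤ) → x - - y ≡ y + x
  sub-neg = solve-∀
  at-K≡2 : ∀ (x : ℤ) → + 1 + x - + 2 + + 1 ≡ x
  at-K≡2 = solve-∀
  sub-two : ∀ (K : ℤ) → K - + 1 - + 1 ≡ K - + 2
  sub-two = solve-∀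
  nonneg : K - + 1 - + 1 ≡ + 0 → + 0 ℤ.≤ a
  nonneg e with ℤP.i-j≡0⇒i≡j K (+ 2) (trans (sym (sub-two K)) e)
  ... | refl = subst (+ 0 ℤ.≤_) (sym (at-K≡2 (+ n))) (ℤ.+≤+ ℕ.z≤n)

-- Two-step recurrences

TwoStepRecurrent : (ℕ → ℤ → ℤ) → Set
TwoStepRecurrent X = ∀ m K → X (suc (suc m)) K ≡ X (suc m) K + X m (K - + 1)

twoStep-unique : ∀ {X Y : ℕ → ℤ → ℤ} → TwoStepRecurrent X → TwoStepRecurrent Y →
                 (∀ K → X 0 K ≡ Y 0 K) → (∀ K → X 1 K ≡ Y 1 K) → ∀ m K → X m K ≡ Y m K
twoStep-unique {X} {Y} X-rec Y-rec X₀≡Y₀ X₁≡Y₁ = go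
  where
  go : ∀ m K → X m K ≡ Y m K
  go zero          = X₀≡Y₀
  go (suc zero)    = X₁≡Y₁
  go (suc (suc m)) K =
    trans (X-rec m K) (trans (cong₂ _+_ (go (suc m) K) (go m (K - + 1))) (sym (Y-rec m K)))

-- F m j is the coefficient of x^j in P_m, where P_{m+2} = P_{m+1} + x² P_m.
record IsFibonacciTriangle (F : ℕ → ℕ → ℤ) : Set where
  field
    corner    : F 0 0 ≡ + 1
    above-row : ∀ m → F (suc m) (suc (suc m)) ≡ + 0
    column₀   : ∀ m → F (suc (suc m)) 0 ≡ F (suc m) 0
    column₁   : ∀ m → F (suc (suc m)) 1 ≡ F (suc m) 1
    pascal    : ∀ m j → F (suc (suc m)) (suc (suc j)) ≡ F (suc m) (suc (suc j)) + F m j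

conv : (ℕ → ℕ → ℤ) → (ℤ → ℕ → ℤ) → ℕ → ℤ → ℤ
conv F I m K = Σ≤ m (λ j → F m j * I K j)

module _ {F : ℕ → ℕ → ℤ} (F-tri : IsFibonacciTriangle F) (I : ℤ → ℕ → ℤ)
         (I-shift : ∀ K j → I K (suc (suc j)) ≡ I (K - + 1) j) where
  open IsFibonacciTriangle F-tri

  conv-recurrent : TwoStepRecurrent (conv F I)
  conv-recurrent m K = begin
    Σ≤ (suc (suc m)) g
      ≡⟨ Σ≤-suc² m g ⟩
    g 0 + (g 1 + Σ≤ m (λ j → g (suc (suc j))))
      ≡⟨ cong₂ (λ u v → u * I K 0 + (v * I K 1 + Σ≤ m (λ j → g (suc (suc j)))))
               (column₀ m) (column₁ m) ⟩
    h 0 + (h 1 + Σ≤ m (λ j → g (suc (suc j))))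
      ≡⟨ cong (λ s → h 0 + (h 1 + s)) (trans (Σ≤-cong m split) (Σ≤-+ m _ _)) ⟩
    h 0 + (h 1 + (Σ≤ m (λ j → h (suc (suc j))) + conv F I m (K - + 1)))
      ≡⟨ reassoc (h 0) (h 1) _ _ ⟩
    (h 0 + (h 1 + Σ≤ m (λ j → h (suc (suc j))))) + conv F I m (K - + 1)
      ≡⟨ cong (_+ conv F I m (K - + 1)) (sym (Σ≤-suc² m h)) ⟩
    conv F I (suc m) K + h (suc (suc m)) + conv F I m (K - + 1)
      ≡⟨ cong (λ x → conv F I (suc m) K + x * I K (suc (suc m)) + conv F I m (K - + 1))
              (above-row m) ⟩
    conv F I (suc m) K + + 0 * I K (suc (suc m)) + conv F I m (K - + 1)
      ≡⟨ cong (_+ conv F I m (K - + 1)) (ℤP.+-identityʳ (conv F I (suc m) K)) ⟩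
    conv F I (suc m) K + conv F I m (K - + 1) ∎
    where
    open ≡-Reasoning
    g h : ℕ → ℤ
    g j = F (suc (suc m)) j * I K j
    h j = F (suc m) j * I K j
    reassoc : ∀ (a b c d : ℤ) → a + (b + (c + d)) ≡ (a + (b + c)) + d
    reassoc = solve-∀
    split : ∀ j → g (suc (suc j)) ≡ h (suc (suc j)) + F m j * I (K - + 1) j
    split j = trans (cong (_* I K (suc (suc j))) (pascal m j))
                    (trans (ℤP.*-distribʳ-+ (I K (suc (suc j))) (F (suc m) (suc (suc j))) (F m j))
                           (cong (λ x → h (suc (suc j)) + F m j * x) (I-shift K j)))

  -- The second base case, m = 2, follows from conv-recurrent 0, which only adds I (K - 1) 0.
  conv-agrees : ∀ (L : ℕ → ℤ → ℤ) → TwoStepRecurrent L →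
                (∀ K → conv F I 1 K ≡ L 0 K) → (∀ K → L 0 K + I (K - + 1) 0 ≡ L 1 K) →
                ∀ m K → conv F I (suc m) K ≡ L m K
  conv-agrees L L-rec base₁ base₂ =
    twoStep-unique (λ m → conv-recurrent (suc m)) L-rec base₁ λ K → begin
      conv F I 2 K
        ≡⟨ conv-recurrent 0 K ⟩
      conv F I 1 K + F 0 0 * I (K - + 1) 0
        ≡⟨ cong₂ _+_ (base₁ K) (trans (cong (_* I (K - + 1) 0) corner) (ℤP.*-identityˡ (I (K - + 1) 0))) ⟩
      L 0 K + I (K - + 1) 0
        ≡⟨ base₂ K ⟩
      L 1 K ∎
    where open ≡-Reasoning

⌊/2⌋≤ : ∀ j → ⌊ j /2⌋ ℕ.≤ j
⌊/2⌋≤ zero          = ℕ.z≤n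
⌊/2⌋≤ (suc zero)    = ℕ.z≤n
⌊/2⌋≤ (suc (suc j)) = ℕ.s≤s (ℕP.m≤n⇒m≤1+n (⌊/2⌋≤ j))

floorTriangle ceilTriangle : ℕ → ℕ → ℤ
floorTriangle m j = binom (+ m - + ⌊ j /2⌋ - + 1) (+ m - + j)
ceilTriangle  m j = binom (+ m - + ⌈ j /2⌉) (+ m - + j)

triangle-pascal : ∀ (A : ℤ) m j → (m ≡ suc j → + 0 ℤ.≤ A) →
  binom (A + + 1) (+ suc (suc m) - + suc (suc j)) ≡ binom A (+ suc m - + suc (suc j)) + binom A (+ m - + j)
triangle-pascal A m j diagonal = begin
  binom (A + + 1) (+ suc (suc m) - + suc (suc j))
    ≡⟨ cong (binom (A + + 1)) (outer (+ m) (+ j)) ⟩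
  binom (A + + 1) (+ m - + j - + 1 + + 1)
    ≡⟨ binom-pascal A (+ m - + j - + 1) (λ e → diagonal (ℤP.+-injective
                      (ℤP.i-j≡0⇒i≡j (+ m) (+ suc j) (trans (assoc (+ m) (+ j)) e)))) ⟩
  binom A (+ m - + j - + 1) + binom A (+ m - + j - + 1 + + 1)
    ≡⟨ cong₂ (λ u v → binom A u + binom A v) (sym (inner (+ m) (+ j))) (sym (pred-suc (+ m - + j))) ⟩
  binom A (+ suc m - + suc (suc j)) + binom A (+ m - + j) ∎
  where
  open ≡-Reasoning
  outer : ∀ (M J : ℤ) → + 2 + M - (+ 2 + J) ≡ M - J - + 1 + + 1
  outer = solve-∀
  inner : ∀ (M J : ℤ) → + 1 + M - (+ 2 + J) ≡ M - J - + 1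
  inner = solve-∀
  pred-suc : ∀ (x : ℤ) → x ≡ x - + 1 + + 1
  pred-suc = solve-∀
  assoc : ∀ (M J : ℤ) → M - (+ 1 + J) ≡ M - J - + 1
  assoc = solve-∀

floorTriangle-isFibonacci : IsFibonacciTriangle floorTriangle
floorTriangle-isFibonacci = record
  { corner    = refl
  ; above-row = λ m → binom-sub-> _ (ℕP.n<1+n (suc m))
  ; column₀   = λ m → trans (column₀≡0 (suc m)) (sym (column₀≡0 m))
  ; column₁   = λ m → trans (column₁≡1 (suc m)) (sym (column₁≡1 m))
  ; pascal    = λ m j →
      trans (cong (λ a → binom a (+ suc (suc m) - + suc (suc j))) (top (+ m) (+ ⌊ j /2⌋)))
      (trans (triangle-pascal (+ m - + ⌊ j /2⌋ - + 1) m j (diagonal j))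
             (cong (λ a → binom a (+ suc m - + suc (suc j)) + floorTriangle m j)
                   (sym (top′ (+ m) (+ ⌊ j /2⌋)))))
  }
  where
  drop-0 : ∀ (M : ℤ) → M - + 0 ≡ M
  drop-0 = solve-∀
  column₀≡0 : ∀ m → floorTriangle (suc m) 0 ≡ + 0
  column₀≡0 m = trans (cong₂ binom (cong (_- + 1) (drop-0 (+ suc m))) (drop-0 (+ suc m)))
                      (binom-+-> (ℕP.n<1+n m))
  column₁≡1 : ∀ m → floorTriangle (suc m) 1 ≡ + 1
  column₁≡1 m = trans (cong (λ a → binom (a - + 1) (+ suc m - + 1)) (drop-0 (+ suc m))) (binom-+-diag m)
  top : ∀ (M H : ℤ) → + 2 + M - (+ 1 + H) - + 1 ≡ M - H - + 1 + + 1
  top = solve-∀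
  top′ : ∀ (M H : ℤ) → + 1 + M - (+ 1 + H) - + 1 ≡ M - H - + 1
  top′ = solve-∀
  cancel : ∀ (J H : ℤ) → + 1 + J - H - + 1 ≡ J - H
  cancel = solve-∀
  diagonal : ∀ {m} j → m ≡ suc j → + 0 ℤ.≤ + m - + ⌊ j /2⌋ - + 1
  diagonal j refl = subst (+ 0 ℤ.≤_) (sym (cancel (+ j) (+ ⌊ j /2⌋)))
                          (ℤP.i≤j⇒0≤j-i (ℤ.+≤+ (⌊/2⌋≤ j)))

ceilTriangle-isFibonacci : IsFibonacciTriangle ceilTriangle
ceilTriangle-isFibonacci = record
  { corner    = refl
  ; above-row = λ m → binom-sub-> _ (ℕP.n<1+n (suc m))
  ; column₀   = λ m → trans (column₀≡1 (suc m)) (sym (column₀≡1 m))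
  ; column₁   = λ m → trans (binom-+-diag (suc m)) (sym (binom-+-diag m))
  ; pascal    = λ m j →
      trans (cong (λ a → binom a (+ suc (suc m) - + suc (suc j))) (top (+ m) (+ ⌈ j /2⌉)))
      (trans (triangle-pascal (+ m - + ⌈ j /2⌉) m j (diagonal j))
             (cong (λ a → binom a (+ suc m - + suc (suc j)) + ceilTriangle m j)
                   (sym (top′ (+ m) (+ ⌈ j /2⌉)))))
  }
  where
  drop-0 : ∀ (M : ℤ) → M - + 0 ≡ M
  drop-0 = solve-∀
  column₀≡1 : ∀ m → ceilTriangle (suc m) 0 ≡ + 1
  column₀≡1 m = trans (cong₂ binom (drop-0 (+ suc m)) (drop-0 (+ suc m))) (binom-+-diag (suc m))
  top : ∀ (M C : ℤ) → + 2 + M - (+ 1 + C) ≡ M - C + + 1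
  top = solve-∀
  top′ : ∀ (M C : ℤ) → + 1 + M - (+ 1 + C) ≡ M - C
  top′ = solve-∀
  diagonal : ∀ {m} j → m ≡ suc j → + 0 ℤ.≤ + m - + ⌈ j /2⌉
  diagonal j refl = ℤP.i≤j⇒0≤j-i (ℤ.+≤+ (⌊/2⌋≤ (suc j)))

diagBinom : ℕ → ℕ → ℕ → ℤ → ℤ
diagBinom c d m K = binom (+ m + + c - K) (K - + d)

diagBinom-recurrent : ∀ c d → d ℕ.≤ c → TwoStepRecurrent (diagBinom c d)
diagBinom-recurrent c d d≤c m K = begin
  binom (+ suc (suc m) + + c - K) (K - + d)
    ≡⟨ cong₂ binom (top (+ m) (+ c) K) (pred-suc (K - + d)) ⟩
  binom (a + + 1) (K - + d - + 1 + + 1)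
    ≡⟨ binom-pascal a (K - + d - + 1) nonneg ⟩
  binom a (K - + d - + 1) + binom a (K - + d - + 1 + + 1)
    ≡⟨ ℤP.+-comm (binom a (K - + d - + 1)) _ ⟩
  binom a (K - + d - + 1 + + 1) + binom a (K - + d - + 1)
    ≡⟨ cong₂ (λ u v → binom a u + binom v (K - + d - + 1))
             (sym (pred-suc (K - + d))) (sym (top′ (+ m) (+ c) K)) ⟩
  binom a (K - + d) + binom (+ m + + c - (K - + 1)) (K - + d - + 1)
    ≡⟨ cong (λ v → binom a (K - + d) + binom (+ m + + c - (K - + 1)) v) (swap K (+ d)) ⟩
  binom a (K - + d) + binom (+ m + + c - (K - + 1)) (K - + 1 - + d) ∎
  where
  open ≡-Reasoning
  a : ℤ
  a = + suc m + + c - K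
  top : ∀ (M C K : ℤ) → + 2 + M + C - K ≡ + 1 + M + C - K + + 1
  top = solve-∀
  top′ : ∀ (M C K : ℤ) → M + C - (K - + 1) ≡ + 1 + M + C - K
  top′ = solve-∀
  pred-suc : ∀ (x : ℤ) → x ≡ x - + 1 + + 1
  pred-suc = solve-∀
  swap : ∀ (K D : ℤ) → K - D - + 1 ≡ K - + 1 - D
  swap = solve-∀
  at-corner : ∀ (M C D : ℤ) → + 1 + M + C - (+ 1 + D) ≡ M + C - D
  at-corner = solve-∀
  swap′ : ∀ (K D : ℤ) → K - (+ 1 + D) ≡ K - D - + 1
  swap′ = solve-∀
  nonneg : K - + d - + 1 ≡ + 0 → + 0 ℤ.≤ a
  nonneg e with ℤP.i-j≡0⇒i≡j K (+ suc d) (trans (swap′ K (+ d)) e)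
  ... | refl = subst (+ 0 ℤ.≤_) (sym (at-corner (+ m) (+ c) (+ d)))
                     (ℤP.i≤j⇒0≤j-i (ℤ.+≤+ (ℕP.≤-trans d≤c (ℕP.m≤n+m c m))))

ceilInner floorInner : ℤ → ℕ → ℕ → ℤ
ceilInner  K i j = binom (+ i - K + + ⌈ j /2⌉ - + 1) (+ i - + 2 * K + + j)
floorInner K i j = binom (+ i - K + + ⌊ j /2⌋) (+ i - + 2 * K + + j + + 1)

ceilInner-shift : ∀ K i j → ceilInner K i (suc (suc j)) ≡ ceilInner (K - + 1) i j
ceilInner-shift K i j = cong₂ binom (top (+ i) K (+ ⌈ j /2⌉)) (bottom (+ i) K (+ j))
  where
  top : ∀ (I K C : ℤ) → I - K + (+ 1 + C) - + 1 ≡ I - (K - + 1) + C - + 1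
  top = solve-∀
  bottom : ∀ (I K J : ℤ) → I - + 2 * K + (+ 2 + J) ≡ I - + 2 * (K - + 1) + J
  bottom = solve-∀

floorInner-shift : ∀ K i j → floorInner K i (suc (suc j)) ≡ floorInner (K - + 1) i j
floorInner-shift K i j = cong₂ binom (top (+ i) K (+ ⌊ j /2⌋)) (bottom (+ i) K (+ j))
  where
  top : ∀ (I K C : ℤ) → I - K + (+ 1 + C) ≡ I - (K - + 1) + C
  top = solve-∀
  bottom : ∀ (I K J : ℤ) → I - + 2 * K + (+ 2 + J) + + 1 ≡ I - + 2 * (K - + 1) + J + + 1
  bottom = solve-∀

ceilInner-0 : ∀ K i → ceilInner K i 0 ≡ skewBinom 2 (K + + 1) i
ceilInner-0 K i = cong₂ binom (top (+ i) K) (bottom (+ i) K)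
  where
  top : ∀ (I K : ℤ) → I - K + + 0 - + 1 ≡ I - (K + + 1)
  top = solve-∀
  bottom : ∀ (I K : ℤ) → I - + 2 * K + + 0 ≡ I - + 2 * (K + + 1) + + 2
  bottom = solve-∀

ceilInner-1 : ∀ K i → ceilInner K i 1 ≡ skewBinom 1 K i
ceilInner-1 K i = cong (λ a → binom a (+ i - + 2 * K + + 1)) (top (+ i) K)
  where
  top : ∀ (I K : ℤ) → I - K + + 1 - + 1 ≡ I - K
  top = solve-∀

floorInner-0 : ∀ K i → floorInner K i 0 ≡ skewBinom 1 K i
floorInner-0 K i =
  cong₂ binom (ℤP.+-identityʳ (+ i - K)) (cong (_+ + 1) (ℤP.+-identityʳ (+ i - + 2 * K)))

floorInner-1 : ∀ K i → floorInner K i 1 ≡ skewBinom 2 K i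
floorInner-1 K i = cong₂ binom (ℤP.+-identityʳ (+ i - K)) (ℤP.+-assoc (+ i - + 2 * K) (+ 1) (+ 1))

column : ℕ → (ℕ → ℕ → ℤ) → (ℤ → ℕ → ℕ → ℤ) → ℤ → ℕ → ℤ
column n w g K j = Σ≤ n (λ i → w i j * g K i j)

column-shift : ∀ n (w : ℕ → ℕ → ℤ) (g : ℤ → ℕ → ℕ → ℤ) →
               (∀ i j → w i (suc (suc j)) ≡ w i j) → (∀ K i j → g K i (suc (suc j)) ≡ g (K - + 1) i j) →
               ∀ K j → column n w g K (suc (suc j)) ≡ column n w g (K - + 1) j
column-shift n w g w-periodic g-shift K j = Σ≤-cong n (λ i → cong₂ _*_ (w-periodic i j) (g-shift K i j))

Σ≤Σ≤≡conv : ∀ n m (w F : ℕ → ℕ → ℤ) (g : ℤ → ℕ → ℕ → ℤ) K →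
  Σ≤ n (λ i → Σ≤ m (λ j → w i j * F m j * g K i j)) ≡ conv F (column n w g) m K
Σ≤Σ≤≡conv n m w F g K = Σ≤-exchange n m w (F m) (g K)

Σ≤-at-top : ∀ n {a s : ℕ → ℤ} (g : ℕ → ℤ) → (∀ i → a i ≡ χ (i ≡ᵇ n)) → s n ≡ + 1 →
            Σ≤ n (λ i → a i * s i * binom (+ n) (+ i) * g i) ≡ g n
Σ≤-at-top n {a} {s} g a≗χ sₙ≡1 = begin
  Σ≤ n (λ i → a i * s i * binom (+ n) (+ i) * g i)
    ≡⟨ Σ≤-cong n (λ i → trans (cong (λ x → x * s i * binom (+ n) (+ i) * g i) (a≗χ i))
                              (assoc (χ (i ≡ᵇ n)) (s i) (binom (+ n) (+ i)) (g i))) ⟩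
  Σ≤ n (λ i → χ (i ≡ᵇ n) * (s i * binom (+ n) (+ i) * g i))
    ≡⟨ Σ≤-χ≡ᵇ n _ ⟩
  s n * binom (+ n) (+ n) * g n
    ≡⟨ cong₂ (λ x y → x * y * g n) sₙ≡1 (binom-+-diag n) ⟩
  + 1 * + 1 * g n
    ≡⟨ ℤP.*-identityˡ (g n) ⟩
  g n ∎
  where
  open ≡-Reasoning
  assoc : ∀ (x y z u : ℤ) → x * y * z * u ≡ x * (y * z * u)
  assoc = solve-∀

column-alt : ∀ n {s g G : ℕ → ℤ} → (∀ i → s i ≡ sgn i) → (∀ i → g i ≡ G i) →
             Σ≤ n (λ i → + 1 * s i * binom (+ n) (+ i) * g i) ≡ alt n G
column-alt n {s} {g} {G} s≗sgn g≗G = Σ≤-cong n λ i →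
  trans (cong₂ (λ x y → + 1 * x * binom (+ n) (+ i) * y) (s≗sgn i) (g≗G i))
        (assoc (sgn i) (binom (+ n) (+ i)) (G i))
  where
  assoc : ∀ (x y z : ℤ) → + 1 * x * y * z ≡ x * (y * z)
  assoc = solve-∀

column-alt-neg : ∀ n {s g G : ℕ → ℤ} → (∀ i → s i ≡ - sgn i) → (∀ i → g i ≡ G i) →
                 Σ≤ n (λ i → + 1 * s i * binom (+ n) (+ i) * g i) ≡ - alt n G
column-alt-neg n {s} {g} {G} s≗-sgn g≗G =
  trans (Σ≤-cong n λ i → trans (cong (λ x → + 1 * x * binom (+ n) (+ i) * g i) (s≗-sgn i))
                               (neg-out (sgn i) (binom (+ n) (+ i)) (g i)))
        (trans (Σ≤-neg n _) (cong -_ (column-alt n (λ _ → refl) g≗G)))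
  where
  neg-out : ∀ (x y z : ℤ) → + 1 * - x * y * z ≡ - (+ 1 * x * y * z)
  neg-out = solve-∀

conv-floorTriangle-1 : ∀ I K → conv floorTriangle I 1 K ≡ I K 1
conv-floorTriangle-1 I K = trans (ℤP.+-identityˡ (+ 1 * I K 1)) (ℤP.*-identityˡ (I K 1))

conv-ceilTriangle-1 : ∀ I K → conv ceilTriangle I 1 K ≡ I K 0 + I K 1
conv-ceilTriangle-1 I K = cong₂ _+_ (ℤP.*-identityˡ (I K 0)) (ℤP.*-identityˡ (I K 1))

identity₁ : ∀ n m K →
  binom (+ suc m + + suc n - K - + 1) (K - + 1)
  ≡ Σ≤ (suc n) (λ i → Σ≤ (suc m) (λ j → α (suc n) i j * sgn (suc i ℕ.* j) * binom (+ suc n) (+ i)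
                                       * floorTriangle (suc m) j * ceilInner K i j))
identity₁ n m K = begin
  binom (+ suc m + + suc n - K - + 1) (K - + 1)
    ≡⟨ cong (λ a → binom a (K - + 1)) (drop-1 (+ m) (+ suc n) K) ⟩
  diagBinom (suc n) 1 m K
    ≡⟨ sym (conv-agrees floorTriangle-isFibonacci I I-shift (diagBinom (suc n) 1)
                        (diagBinom-recurrent (suc n) 1 (ℕ.s≤s ℕ.z≤n)) base₁ base₂ m K) ⟩
  conv floorTriangle I (suc m) K
    ≡⟨ sym (Σ≤Σ≤≡conv (suc n) (suc m) w floorTriangle ceilInner K) ⟩
  _ ∎
  where
  open ≡-Reasoning
  drop-1 : ∀ (M N K : ℤ) → + 1 + M + N - K - + 1 ≡ M + N - K
  drop-1 = solve-∀
  w : ℕ → ℕ → ℤ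
  w i j = α (suc n) i j * sgn (suc i ℕ.* j) * binom (+ suc n) (+ i)
  I : ℤ → ℕ → ℤ
  I = column (suc n) w ceilInner
  I-shift : ∀ K j → I K (suc (suc j)) ≡ I (K - + 1) j
  I-shift = column-shift (suc n) w ceilInner
    (λ i j → cong₂ (λ a s → a * s * binom (+ suc n) (+ i)) (α-2+ (suc n) i j) (sgn-*-2+ (suc i) j))
    ceilInner-shift
  I₀ : ∀ K → I K 0 ≡ ceilInner K (suc n) 0
  I₀ K = Σ≤-at-top (suc n) (λ i → ceilInner K i 0) (α-0 (suc n)) (sgn-*0 (suc (suc n)))
  I₁ : ∀ K → I K 1 ≡ binom (+ suc n - K) (K - + 1)
  I₁ K = trans (column-alt-neg (suc n) (λ i → trans (sgn-*1 (suc i)) (sgn-suc i)) (ceilInner-1 K))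
               (trans (cong -_ (proj₁ (alt-skewBinom n K))) (ℤP.neg-involutive _))
  base₁ : ∀ K → conv floorTriangle I 1 K ≡ diagBinom (suc n) 1 0 K
  base₁ K = trans (conv-floorTriangle-1 I K) (I₁ K)
  base₂ : ∀ K → diagBinom (suc n) 1 0 K + I (K - + 1) 0 ≡ diagBinom (suc n) 1 1 K
  base₂ K = begin
    binom a (K - + 1) + I (K - + 1) 0
      ≡⟨ cong (_+_ (binom a (K - + 1)))
              (trans (I₀ (K - + 1)) (cong₂ binom (top (+ n) K) (bottom (+ n) K))) ⟩
    binom a (K - + 1) + binom a (a - (K - + 1) + + 1)
      ≡⟨ binom-pascal-sym a (K - + 1) (nonneg-or-pred-pos n K) ⟩
    binom (a + + 1) (K - + 1)
      ≡⟨ cong (λ x → binom x (K - + 1)) (top′ (+ n) K) ⟩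
    diagBinom (suc n) 1 1 K ∎
    where
    a : ℤ
    a = + suc n - K
    top : ∀ (N K : ℤ) → + 1 + N - (K - + 1) + + 0 - + 1 ≡ + 1 + N - K
    top = solve-∀
    bottom : ∀ (N K : ℤ) → + 1 + N - + 2 * (K - + 1) + + 0 ≡ + 1 + N - K - (K - + 1) + + 1
    bottom = solve-∀
    top′ : ∀ (N K : ℤ) → + 1 + N - K + + 1 ≡ + 2 + N - K
    top′ = solve-∀

identity₂ : ∀ n m K →
  binom (+ suc m + + suc n - K) (K - + 1)
  ≡ Σ≤ (suc n) (λ i → Σ≤ (suc m) (λ j → α (suc n) i j * sgn (i ℕ.* j) * binom (+ suc n) (+ i)
                                       * floorTriangle (suc m) j * floorInner K i j))
identity₂ n m K = begin
  diagBinom (suc n) 1 (suc m) K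
    ≡⟨ sym (conv-agrees floorTriangle-isFibonacci I I-shift (λ m → diagBinom (suc n) 1 (suc m))
                        (λ m → diagBinom-recurrent (suc n) 1 (ℕ.s≤s ℕ.z≤n) (suc m)) base₁ base₂ m K) ⟩
  conv floorTriangle I (suc m) K
    ≡⟨ sym (Σ≤Σ≤≡conv (suc n) (suc m) w floorTriangle floorInner K) ⟩
  _ ∎
  where
  open ≡-Reasoning
  w : ℕ → ℕ → ℤ
  w i j = α (suc n) i j * sgn (i ℕ.* j) * binom (+ suc n) (+ i)
  I : ℤ → ℕ → ℤ
  I = column (suc n) w floorInner
  I-shift : ∀ K j → I K (suc (suc j)) ≡ I (K - + 1) j
  I-shift = column-shift (suc n) w floorInner
    (λ i j → cong₂ (λ a s → a * s * binom (+ suc n) (+ i)) (α-2+ (suc n) i j) (sgn-*-2+ i j))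
    floorInner-shift
  I₀ : ∀ K → I K 0 ≡ floorInner K (suc n) 0
  I₀ K = Σ≤-at-top (suc n) (λ i → floorInner K i 0) (α-0 (suc n)) (sgn-*0 (suc n))
  I₁ : ∀ K → I K 1 ≡ binom (+ suc n - K + + 1) (K - + 1)
  I₁ K = trans (column-alt (suc n) sgn-*1 (floorInner-1 K)) (proj₂ (alt-skewBinom n K))
  shift-top : ∀ (N K : ℤ) → + 1 + N - K + + 1 ≡ + 2 + N - K
  shift-top = solve-∀
  base₁ : ∀ K → conv floorTriangle I 1 K ≡ diagBinom (suc n) 1 1 K
  base₁ K = trans (conv-floorTriangle-1 I K)
                  (trans (I₁ K) (cong (λ a → binom a (K - + 1)) (shift-top (+ n) K)))
  base₂ : ∀ K → diagBinom (suc n) 1 1 K + I (K - + 1) 0 ≡ diagBinom (suc n) 1 2 K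
  base₂ K = begin
    binom a (K - + 1) + I (K - + 1) 0
      ≡⟨ cong (_+_ (binom a (K - + 1)))
              (trans (I₀ (K - + 1)) (cong₂ binom (top (+ n) K) (bottom (+ n) K))) ⟩
    binom a (K - + 1) + binom a (a - (K - + 1) + + 1)
      ≡⟨ binom-pascal-sym a (K - + 1) (nonneg-or-pred-pos (suc n) K) ⟩
    binom (a + + 1) (K - + 1)
      ≡⟨ cong (λ x → binom x (K - + 1)) (shift-top (+ suc n) K) ⟩
    diagBinom (suc n) 1 2 K ∎
    where
    a : ℤ
    a = + suc (suc n) - K
    top : ∀ (N K : ℤ) → + 1 + N - (K - + 1) + + 0 ≡ + 2 + N - K
    top = solve-∀
    bottom : ∀ (N K : ℤ) → + 1 + N - + 2 * (K - + 1) + + 0 + + 1 ≡ + 2 + N - K - (K - + 1) + + 1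
    bottom = solve-∀

identity₃ : ∀ n m K →
  binom (+ suc m + + suc n - K) K
  ≡ Σ≤ (suc n) (λ i → Σ≤ (suc m) (λ j → β (suc n) i j * sgn (i ℕ.* suc j) * binom (+ suc n) (+ i)
                                       * ceilTriangle (suc m) j * ceilInner K i j))
identity₃ n m K = begin
  binom (+ suc m + + suc n - K) K
    ≡⟨ cong (binom (+ suc m + + suc n - K)) (sym (ℤP.+-identityʳ K)) ⟩
  diagBinom (suc n) 0 (suc m) K
    ≡⟨ sym (conv-agrees ceilTriangle-isFibonacci I I-shift (λ m → diagBinom (suc n) 0 (suc m))
                        (λ m → L-rec (suc m)) base₁ base₂ m K) ⟩
  conv ceilTriangle I (suc m) K
    ≡⟨ sym (Σ≤Σ≤≡conv (suc n) (suc m) w ceilTriangle ceilInner K) ⟩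
  _ ∎
  where
  open ≡-Reasoning
  L-rec : TwoStepRecurrent (diagBinom (suc n) 0)
  L-rec = diagBinom-recurrent (suc n) 0 ℕ.z≤n
  w : ℕ → ℕ → ℤ
  w i j = β (suc n) i j * sgn (i ℕ.* suc j) * binom (+ suc n) (+ i)
  I : ℤ → ℕ → ℤ
  I = column (suc n) w ceilInner
  I-shift : ∀ K j → I K (suc (suc j)) ≡ I (K - + 1) j
  I-shift = column-shift (suc n) w ceilInner
    (λ i j → cong₂ (λ b s → b * s * binom (+ suc n) (+ i)) (β-2+ (suc n) i j) (sgn-*-2+ i (suc j)))
    ceilInner-shift
  I₀ : ∀ K → I K 0 ≡ diagBinom (suc n) 0 0 K
  I₀ K = trans (column-alt (suc n) sgn-*1 (ceilInner-0 K))
               (trans (proj₂ (alt-skewBinom n (K + + 1))) (cong₂ binom (top (+ suc n) K) (bottom K)))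
    where
    top : ∀ (N K : ℤ) → N - (K + + 1) + + 1 ≡ N - K
    top = solve-∀
    bottom : ∀ (K : ℤ) → K + + 1 - + 1 ≡ K - + 0
    bottom = solve-∀
  I₁ : ∀ K → I K 1 ≡ ceilInner K (suc n) 1
  I₁ K = Σ≤-at-top (suc n) (λ i → ceilInner K i 1) (β-1 (suc n)) (sgn-*2 (suc n))
  base₁ : ∀ K → conv ceilTriangle I 1 K ≡ diagBinom (suc n) 0 1 K
  base₁ K = begin
    conv ceilTriangle I 1 K
      ≡⟨ conv-ceilTriangle-1 I K ⟩
    I K 0 + I K 1
      ≡⟨ cong₂ _+_ (trans (I₀ K) (cong (binom a) (ℤP.+-identityʳ K)))
                   (trans (I₁ K) (cong₂ binom (top (+ suc n) K) (bottom (+ suc n) K))) ⟩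
    binom a K + binom a (a - K + + 1)
      ≡⟨ binom-pascal-sym a K nonneg-or-pos ⟩
    binom (a + + 1) K
      ≡⟨ cong₂ binom (top′ (+ n) K) (sym (ℤP.+-identityʳ K)) ⟩
    diagBinom (suc n) 0 1 K ∎
    where
    a : ℤ
    a = + suc n - K
    top : ∀ (N K : ℤ) → N - K + + 1 - + 1 ≡ N - K
    top = solve-∀
    bottom : ∀ (N K : ℤ) → N - + 2 * K + + 1 ≡ N - K - K + + 1
    bottom = solve-∀
    top′ : ∀ (N K : ℤ) → + 1 + N - K + + 1 ≡ + 2 + N - K
    top′ = solve-∀
    nonneg-or-pos : + 0 ℤ.≤ a ⊎ + 0 ℤ.< K
    nonneg-or-pos with nonneg-or-exceeds (suc n) K
    ... | inj₁ 0≤a                = inj₁ 0≤a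
    ... | inj₂ (suc k , refl , _) = inj₂ (ℤ.+<+ (ℕ.s≤s ℕ.z≤n))
  base₂ : ∀ K → diagBinom (suc n) 0 1 K + I (K - + 1) 0 ≡ diagBinom (suc n) 0 2 K
  base₂ K = trans (cong (_+_ (diagBinom (suc n) 0 1 K)) (I₀ (K - + 1))) (sym (L-rec 0 K))

identity₄ : ∀ n m K →
  binom (+ suc m + + suc n - K) (K - + 1)
  ≡ Σ≤ (suc n) (λ i → Σ≤ (suc m) (λ j → β (suc n) i j * sgn (suc i ℕ.* suc j) * binom (+ suc n) (+ i)
                                       * ceilTriangle (suc m) j * floorInner K i j))
identity₄ n m K = begin
  diagBinom (suc n) 1 (suc m) K
    ≡⟨ sym (conv-agrees ceilTriangle-isFibonacci I I-shift (λ m → diagBinom (suc n) 1 (suc m))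
                        (λ m → L-rec (suc m)) base₁ base₂ m K) ⟩
  conv ceilTriangle I (suc m) K
    ≡⟨ sym (Σ≤Σ≤≡conv (suc n) (suc m) w ceilTriangle floorInner K) ⟩
  _ ∎
  where
  open ≡-Reasoning
  L-rec : TwoStepRecurrent (diagBinom (suc n) 1)
  L-rec = diagBinom-recurrent (suc n) 1 (ℕ.s≤s ℕ.z≤n)
  w : ℕ → ℕ → ℤ
  w i j = β (suc n) i j * sgn (suc i ℕ.* suc j) * binom (+ suc n) (+ i)
  I : ℤ → ℕ → ℤ
  I = column (suc n) w floorInner
  I-shift : ∀ K j → I K (suc (suc j)) ≡ I (K - + 1) j
  I-shift = column-shift (suc n) w floorInner
    (λ i j → cong₂ (λ b s → b * s * binom (+ suc n) (+ i)) (β-2+ (suc n) i j) (sgn-*-2+ (suc i) (suc j)))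
    floorInner-shift
  I₀ : ∀ K → I K 0 ≡ diagBinom (suc n) 1 0 K
  I₀ K = trans (column-alt-neg (suc n) (λ i → trans (sgn-*1 (suc i)) (sgn-suc i)) (floorInner-0 K))
               (trans (cong -_ (proj₁ (alt-skewBinom n K))) (ℤP.neg-involutive _))
  I₁ : ∀ K → I K 1 ≡ floorInner K (suc n) 1
  I₁ K = Σ≤-at-top (suc n) (λ i → floorInner K i 1) (β-1 (suc n)) (sgn-*2 (suc (suc n)))
  base₁ : ∀ K → conv ceilTriangle I 1 K ≡ diagBinom (suc n) 1 1 K
  base₁ K = begin
    conv ceilTriangle I 1 K
      ≡⟨ conv-ceilTriangle-1 I K ⟩
    I K 0 + I K 1
      ≡⟨ cong₂ _+_ (I₀ K) (trans (I₁ K) (cong₂ binom (ℤP.+-identityʳ a) (bottom (+ suc n) K))) ⟩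
    binom a (K - + 1) + binom a (a - (K - + 1) + + 1)
      ≡⟨ binom-pascal-sym a (K - + 1) (nonneg-or-pred-pos n K) ⟩
    binom (a + + 1) (K - + 1)
      ≡⟨ cong (λ x → binom x (K - + 1)) (top′ (+ n) K) ⟩
    diagBinom (suc n) 1 1 K ∎
    where
    a : ℤ
    a = + suc n - K
    bottom : ∀ (N K : ℤ) → N - + 2 * K + + 1 + + 1 ≡ N - K - (K - + 1) + + 1
    bottom = solve-∀
    top′ : ∀ (N K : ℤ) → + 1 + N - K + + 1 ≡ + 2 + N - K
    top′ = solve-∀
  base₂ : ∀ K → diagBinom (suc n) 1 1 K + I (K - + 1) 0 ≡ diagBinom (suc n) 1 2 K
  base₂ K = trans (cong (_+_ (diagBinom (suc n) 1 1 K)) (I₀ (K - + 1))) (sym (L-rec 0 K))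

proposition2p3 : (m n k : ℕ) → 1 ℕ.≤ m → 1 ℕ.≤ n → 1 ℕ.≤ k →
  (binom (+ m + + n - + k - + 1) (+ k - + 1)
    ≡ Σ≤ n (λ i → Σ≤ m (λ j → α n i j * sgn ((suc i) ℕ.* j) * binom (+ n) (+ i)
        * binom (+ m - + ⌊ j /2⌋ - + 1) (+ m - + j)
        * binom (+ i - + k + + ⌈ j /2⌉ - + 1) (+ i - + 2 * + k + + j))))
  × (binom (+ m + + n - + k) (+ k - + 1)
    ≡ Σ≤ n (λ i → Σ≤ m (λ j → α n i j * sgn (i ℕ.* j) * binom (+ n) (+ i)
        * binom (+ m - + ⌊ j /2⌋ - + 1) (+ m - + j)
        * binom (+ i - + k + + ⌊ j /2⌋) (+ i - + 2 * + k + + j + + 1))))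
  × (binom (+ m + + n - + k) (+ k)
    ≡ Σ≤ n (λ i → Σ≤ m (λ j → β n i j * sgn (i ℕ.* suc j) * binom (+ n) (+ i)
        * binom (+ m - + ⌈ j /2⌉) (+ m - + j)
        * binom (+ i - + k + + ⌈ j /2⌉ - + 1) (+ i - + 2 * + k + + j))))
  × (binom (+ m + + n - + k) (+ k - + 1)
    ≡ Σ≤ n (λ i → Σ≤ m (λ j → β n i j * sgn (suc i ℕ.* suc j) * binom (+ n) (+ i)
        * binom (+ m - + ⌈ j /2⌉) (+ m - + j)
        * binom (+ i - + k + + ⌊ j /2⌋) (+ i - + 2 * + k + + j + + 1))))
-- Each identity holds for every integer k.
proposition2p3 (suc m) (suc n) k (ℕ.s≤s _) (ℕ.s≤s _) _ =
  identity₁ n m (+ k) , identity₂ n m (+ k) , identity₃ n m (+ k) , identity₄ n m (+ k)
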